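{- Let $R$ be a $*$-ring and let $a$ be a cut vertex of $\Gamma^*_s(R)$. Then $r_R(aR)$ is properly maximal, i.e. for every $b\in R\setminus\{0,a\}$ we have $r_R(aR)\not\subseteq r_R(bR)$.
   Context: A $*$-ring is a ring $R$ with an involution $x\mapsto x^*$. For $S\subseteq R$, $r_R(S)=\{x\in R: sx=0\ \forall s\in S\}$. The strong zero-divisor graph $\Gamma^*_s(R)$ is the simple undirected graph with vertex set $\{0\neq a\in R: r_R(aR)\neq\{0\}\}$, in which distinct vertices $a,b$ are adjacent iff $aRb^*=0$. A cut vertex is a vertex whose removal increases the number of connected components. -}

module Defs where

open import Level using (Level; suc; _⊔_)
open import Algebra.Structures using (IsRingWithoutOne)
open import Data.Product using (Σ; ∃; _×_)
open import Relation.Binary.PropositionalEquality using (_≡_; _≢_)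
open import Relation.Nullary using (¬_)

record StarRing (c : Level) : Set (suc c) where
  infixl 7 _*_
  infixl 6 _+_
  infix  8 _⋆
  field
    Carrier : Set c
    _+_ : Carrier → Carrier → Carrier
    _*_ : Carrier → Carrier → Carrier
    -_  : Carrier → Carrier
    0#  : Carrier
    isRingWithoutOne : IsRingWithoutOne _≡_ _+_ _*_ -_ 0#
    _⋆  : Carrier → Carrier
    ⋆-+ : ∀ x y → (x + y) ⋆ ≡ x ⋆ + y ⋆
    ⋆-* : ∀ x y → (x * y) ⋆ ≡ y ⋆ * x ⋆
    ⋆-invol : ∀ x → (x ⋆) ⋆ ≡ x

module _ {c : Level} (R : StarRing c) where
  open StarRing R

  InRightAnnOf : Carrier → Carrier → Set c
  InRightAnnOf a x = ∀ r → (a * r) * x ≡ 0#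

  IsVertex : Carrier → Set c
  IsVertex a = a ≢ 0# × ∃ λ x → x ≢ 0# × InRightAnnOf a x

  Adj : Carrier → Carrier → Set c
  Adj a b = IsVertex a × IsVertex b × a ≢ b × (∀ r → (a * r) * (b ⋆) ≡ 0#)

  data Walk (Allowed : Carrier → Set c) : Carrier → Carrier → Set c where
    here : ∀ {u} → IsVertex u → Allowed u → Walk Allowed u u
    step : ∀ {u v w} → Allowed u → Adj u v → Walk Allowed v w → Walk Allowed u w

  Anywhere : Carrier → Set c
  Anywhere _ = Level.Lift c Data.Unit.⊤
    where import Data.Unit

  -- a is a cut vertex: a is a vertex, and there are vertices u, v ≠ a lying in
  -- the same component of Γ*_s(R) which lie in different components of Γ*_s(R) − a
  IsCutVertex : Carrier → Set c
  IsCutVertex a =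
    IsVertex a ×
    ∃ λ u → ∃ λ v → u ≢ a × v ≢ a ×
      Walk Anywhere u v × ¬ Walk (λ w → w ≢ a) u v

{-# OPTIONS --safe #-}
module Submission where

-- If r(aR) ⊆ r(bR) with b ≠ 0, a, then b is a vertex and every neighbour x ≠ b
-- of a is also a neighbour of b (x R a⋆ = 0 ⟹ a R x⋆ = 0 ⟹ b R x⋆ = 0 ⟹ x R b⋆ = 0).
-- So every passage u — a — q of a walk can be replaced by u — b — q, and
-- removing a disconnects nothing: a is not a cut vertex.

open import Defs
open import Level using (Level)
open import Algebra.Structures using (IsRingWithoutOne)
open import Data.Product using (_,_)
open import Effect.Monad using (RawMonad)
open import Relation.Binary.PropositionalEquality using (_≡_; _≢_; refl; cong; ≢-sym; module ≡-Reasoning)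
open import Relation.Nullary using (¬_; Dec; yes; no)
open import Relation.Nullary.Decidable using (¬¬-excluded-middle)
open import Relation.Nullary.Negation using (¬¬-Monad; contradiction)

module _ {c : Level} (R : StarRing c) where
  open StarRing R
  open IsRingWithoutOne isRingWithoutOne using (*-assoc; zeroʳ)
  open ≡-Reasoning

  ⋆-zero : 0# ⋆ ≡ 0#
  ⋆-zero = begin
    0# ⋆                ≡⟨ cong _⋆ (zeroʳ (0# ⋆)) ⟨
    (0# ⋆ * 0#) ⋆       ≡⟨ ⋆-* (0# ⋆) 0# ⟩
    0# ⋆ * (0# ⋆) ⋆     ≡⟨ cong (0# ⋆ *_) (⋆-invol 0#) ⟩
    0# ⋆ * 0#           ≡⟨ zeroʳ (0# ⋆) ⟩
    0#                  ∎

  InRightAnnOf-⋆-swap : ∀ {x y} → InRightAnnOf R x (y ⋆) → InRightAnnOf R y (x ⋆)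
  InRightAnnOf-⋆-swap {x} {y} xRy⋆ r = begin
    (y * r) * x ⋆               ≡⟨ *-assoc y r (x ⋆) ⟩
    y * (r * x ⋆)               ≡⟨ cong (λ s → y * (s * x ⋆)) (⋆-invol r) ⟨
    y * ((r ⋆) ⋆ * x ⋆)         ≡⟨ cong (y *_) (⋆-* x (r ⋆)) ⟨
    y * (x * r ⋆) ⋆             ≡⟨ cong (_* (x * r ⋆) ⋆) (⋆-invol y) ⟨
    (y ⋆) ⋆ * (x * r ⋆) ⋆       ≡⟨ ⋆-* (x * r ⋆) (y ⋆) ⟨
    ((x * r ⋆) * y ⋆) ⋆         ≡⟨ cong _⋆ (xRy⋆ (r ⋆)) ⟩
    0# ⋆                        ≡⟨ ⋆-zero ⟩
    0#                          ∎

  Adj-sym : ∀ {x y} → Adj R x y → Adj R y x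
  Adj-sym (vx , vy , x≢y , xRy⋆) = vy , vx , ≢-sym x≢y , InRightAnnOf-⋆-swap xRy⋆

  module _ {a b : Carrier} (b≢0 : b ≢ 0#)
           (ann-⊆ : ∀ x → InRightAnnOf R a x → InRightAnnOf R b x) where

    IsVertex-ann-⊆ : IsVertex R a → IsVertex R b
    IsVertex-ann-⊆ (_ , y , y≢0 , aRy) = b≢0 , y , y≢0 , ann-⊆ y aRy

    Adj-ann-⊆ : ∀ {x} → Adj R x a → x ≢ b → Adj R x b
    Adj-ann-⊆ {x} (vx , va , _ , xRa⋆) x≢b =
      vx , IsVertex-ann-⊆ va , x≢b ,
      InRightAnnOf-⋆-swap (ann-⊆ (x ⋆) (InRightAnnOf-⋆-swap xRa⋆))

  module Rerouting {a b : Carrier} (b≢a : b ≢ a)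
                   (absorb : ∀ {x} → Adj R x a → x ≢ b → Adj R x b) where

    Avoiding : Carrier → Set c
    Avoiding w = w ≢ a

    enter-b : ∀ {u v} → u ≢ a → Adj R u a → Walk R Avoiding b v →
              Dec (u ≡ b) → Walk R Avoiding u v
    enter-b _ _ w (yes refl) = w
    enter-b u≢a ua w (no u≢b) = step u≢a (absorb ua u≢b) w

    leave-b : ∀ {q v} → Adj R a q → Walk R Avoiding q v →
              Dec (q ≡ b) → Walk R Avoiding b v
    leave-b _ w (yes refl) = w
    leave-b aq w (no q≢b) = step b≢a (Adj-sym (absorb (Adj-sym aq) q≢b)) w

    -- Equality in R is not decidable, so the case splits "u = b?", "q = b?"
    -- are only available under a double negation, which is all a negative goal needs.
    open RawMonad (¬¬-Monad {c}) using (pure; _<$>_; _>>=_)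

    detour : ∀ {u q v} → u ≢ a → Adj R u a → Adj R a q →
             Walk R Avoiding q v → ¬ ¬ Walk R Avoiding u v
    detour u≢a ua aq w = do
      u≟b ← ¬¬-excluded-middle
      q≟b ← ¬¬-excluded-middle
      pure (enter-b u≢a ua (leave-b aq w q≟b) u≟b)

    mutual
      avoid : ∀ {u v} → u ≢ a → v ≢ a →
              Walk R (Anywhere R) u v → ¬ ¬ Walk R Avoiding u v
      avoid u≢a v≢a (here vu _)   = pure (here vu u≢a)
      avoid u≢a v≢a (step _ um w) = ¬¬-excluded-middle >>= λ where
        (yes m≡a) → avoid-after-a u≢a v≢a um m≡a w
        (no m≢a)  → step u≢a um <$> avoid m≢a v≢a w

      avoid-after-a : ∀ {u m v} → u ≢ a → v ≢ a → Adj R u m → m ≡ a →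
                      Walk R (Anywhere R) m v → ¬ ¬ Walk R Avoiding u v
      avoid-after-a _ v≢a _ refl (here _ _) = contradiction refl v≢a
      avoid-after-a u≢a v≢a ua refl (step _ aq@(_ , _ , a≢q , _) w) =
        avoid (≢-sym a≢q) v≢a w >>= detour u≢a ua aq

proposition2p11 : ∀ {c : Level} (R : StarRing c) (a : StarRing.Carrier R) →
    IsCutVertex R a →
    ∀ (b : StarRing.Carrier R) → b ≢ StarRing.0# R → b ≢ a →
    ¬ (∀ x → InRightAnnOf R a x → InRightAnnOf R b x)
proposition2p11 R a (_ , u , v , u≢a , v≢a , walk , no-avoiding-walk) b b≢0 b≢a ann-⊆ =
  avoid u≢a v≢a walk no-avoiding-walk
  where open Rerouting R b≢a (Adj-ann-⊆ R b≢0 ann-⊆)
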